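{- Let $q\ge2$ be a prime power, $V$ an $n$-dimensional vector space over $\mathbb{F}_q$, and $n,k,t,s$ positive integers with $k\ge t+1$ and $n\ge 2k$. Let $\mathcal{F},\mathcal{G}\subseteq{V\brack k}$ be non-empty $s$-almost cross-$t$-intersecting families with $\tau_t(\mathcal{G})\le k$. If $H$ is a subspace of $V$ with $\dim(H)\le\tau_t(\mathcal{G})$, then $$|\mathcal{F}_H|\le{k-t+1\brack 1}^{\tau_t(\mathcal{G})-\dim(H)}{n-\tau_t(\mathcal{G})\brack k-\tau_t(\mathcal{G})}+s\sum_{i=0}^{\tau_t(\mathcal{G})-\dim(H)-1}{k-t+1\brack 1}^i.$$
   Context: ${V\brack k}$ is the set of $k$-dimensional subspaces of $V$; Gaussian binomial ${a\brack b}=\prod_{0\le i<b}\frac{q^{a-i}-1}{q^{b-i}-1}$, ${a\brack 0}=1$, ${a\brack b}=0$ for $b<0$. For a family $\mathcal{G}$ and subspace $F$, $\mathcal{D}_{\mathcal{G}}(F;t)=\{G\in\mathcal{G}:\dim(G\cap F)<t\}$; $\mathcal{F},\mathcal{G}$ are $s$-almost cross-$t$-intersecting if $|\mathcal{D}_{\mathcal{G}}(F;t)|\le s$ for all $F\in\mathcal{F}$ and $|\mathcal{D}_{\mathcal{F}}(G;t)|\le s$ for all $G\in\mathcal{G}$. A subspace $T$ of $V$ is a $t$-cover of a family $\mathcal{G}$ if $\dim(T\cap G)\ge t$ for all $G\in\mathcal{G}$; the $t$-covering number $\tau_t(\mathcal{G})$ is the minimum dimension of a $t$-cover of $\mathcal{G}$.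 For a subspace $H$, $\mathcal{F}_H=\{F\in\mathcal{F}:H\subseteq F\}$. -}

module Defs where

open import Level using (0ℓ)
open import Data.Nat using (ℕ; zero; suc; _+_; _*_; _∸_; _^_; _≤_; _<_)
open import Data.Nat.DivMod using (_/_)
open import Data.Product using (Σ; ∃; _×_; _,_)
open import Data.List using (List; length)
open import Data.List.Relation.Unary.Unique.Propositional using (Unique)
open import Data.List.Relation.Unary.All using (All)
open import Data.List.Relation.Unary.AllPairs using (AllPairs)
open import Data.List.Membership.Propositional using (_∈_)
open import Data.Vec using (Vec; []; _∷_; replicate; zipWith; map)
open import Data.Empty using (⊥)
open import Relation.Nullary using (¬_)
open import Relation.Binary.PropositionalEquality using (_≡_)
open import Algebra.Structures using (IsCommutativeRing)

record FiniteField : Set₁ where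
  field
    Carrier : Set
    _+F_ _*F_ : Carrier → Carrier → Carrier
    -F_ : Carrier → Carrier
    0F 1F : Carrier
    isCommutativeRing : IsCommutativeRing _≡_ _+F_ _*F_ -F_ 0F 1F
    0≢1 : ¬ (0F ≡ 1F)
    inverse : ∀ x → ¬ (x ≡ 0F) → Σ Carrier (λ y → x *F y ≡ 1F)
    elements : List Carrier
    elements-unique : Unique elements
    elements-complete : ∀ x → x ∈ elements

  size : ℕ
  size = length elements

module LinAlg (𝔽 : FiniteField) where
  open FiniteField 𝔽

  Vect : ℕ → Set
  Vect n = Vec Carrier n

  zeroV : ∀ {n} → Vect n
  zeroV = replicate _ 0F

  _+V_ : ∀ {n} → Vect n → Vect n → Vect n
  _+V_ = zipWith _+F_

  _·V_ : ∀ {n} → Carrier → Vect n → Vect n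
  c ·V v = map (c *F_) v

  linComb : ∀ {n d} → Vec Carrier d → Vec (Vect n) d → Vect n
  linComb [] [] = zeroV
  linComb (c ∷ cs) (b ∷ bs) = (c ·V b) +V linComb cs bs

  record Subspace (n : ℕ) : Set₁ where
    field
      _∋_ : Vect n → Set
      zero∈ : _∋_ zeroV
      +∈ : ∀ {u v} → _∋_ u → _∋_ v → _∋_ (u +V v)
      ·∈ : ∀ c {v} → _∋_ v → _∋_ (c ·V v)
  open Subspace public

  _≐_ : ∀ {n} → Subspace n → Subspace n → Set
  U ≐ W = ∀ v → (U ∋ v → W ∋ v) × (W ∋ v → U ∋ v)

  _⊆S_ : ∀ {n} → Subspace n → Subspace n → Set
  U ⊆S W = ∀ v → U ∋ v → W ∋ v

  _∩S_ : ∀ {n} → Subspace n → Subspace n → Subspace n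
  U ∩S W = record
    { _∋_ = λ v → (U ∋ v) × (W ∋ v)
    ; zero∈ = zero∈ U , zero∈ W
    ; +∈ = λ { (a , b) (c , d) → +∈ U a c , +∈ W b d }
    ; ·∈ = λ { c (a , b) → ·∈ U c a , ·∈ W c b }
    }

  LinIndep : ∀ {n d} → Vec (Vect n) d → Set
  LinIndep {d = d} bs = ∀ (cs : Vec Carrier d) → linComb cs bs ≡ zeroV → cs ≡ replicate d 0F

  InSpan : ∀ {n d} → Vec (Vect n) d → Vect n → Set
  InSpan {d = d} bs v = Σ (Vec Carrier d) (λ cs → linComb cs bs ≡ v)

  HasDim : ∀ {n} → Subspace n → ℕ → Set
  HasDim {n} W d = Σ (Vec (Vect n) d) λ bs →
    LinIndep bs × (∀ v → (W ∋ v → InSpan bs v) × (InSpan bs v → W ∋ v))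

  DimLt : ∀ {n} → Subspace n → ℕ → Set
  DimLt W t = ∃ λ d → HasDim W d × d < t

  DimGe : ∀ {n} → Subspace n → ℕ → Set
  DimGe W t = ∃ λ d → HasDim W d × t ≤ d

  Family : ℕ → Set₁
  Family n = Subspace n → Set

  -- |{ W : P W }| ≤ s  (subspaces counted up to equality as sets)
  CardAtMost : ∀ {n} → Family n → ℕ → Set₁
  CardAtMost {n} P s = ∀ (xs : List (Subspace n)) →
    AllPairs (λ U W → ¬ (U ≐ W)) xs → All P xs → length xs ≤ s

  NonEmpty : ∀ {n} → Family n → Set₁
  NonEmpty {n} P = Σ (Subspace n) P

  IsKFamily : ∀ {n} → Family n → ℕ → Set₁
  IsKFamily {n} P k = ∀ (W : Subspace n) → P W → HasDim W k

  𝒟 : ∀ {n} → Family n → Subspace n → ℕ → Family n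
  𝒟 𝓖 F t G = 𝓖 G × DimLt (G ∩S F) t

  AlmostCrossIntersecting : ∀ {n} → ℕ → ℕ → Family n → Family n → Set₁
  AlmostCrossIntersecting {n} s t 𝓕 𝓖 =
    (∀ (F : Subspace n) → 𝓕 F → CardAtMost (𝒟 𝓖 F t) s) ×
    (∀ (G : Subspace n) → 𝓖 G → CardAtMost (𝒟 𝓕 G t) s)

  IsTCover : ∀ {n} → ℕ → Family n → Subspace n → Set₁
  IsTCover {n} t 𝓖 T = ∀ (G : Subspace n) → 𝓖 G → DimGe (T ∩S G) t

  IsCoveringNumber : ∀ {n} → ℕ → Family n → ℕ → Set₁
  IsCoveringNumber {n} t 𝓖 τ =
    (Σ (Subspace n) λ T → HasDim T τ × IsTCover t 𝓖 T) ×
    (∀ (T : Subspace n) (d : ℕ) → HasDim T d → IsTCover t 𝓖 T → τ ≤ d)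

  Containing : ∀ {n} → Family n → Subspace n → Family n
  Containing 𝓕 H F = 𝓕 F × (H ⊆S F)

-- Gaussian binomial [a b]_q = ∏_{0≤i<b} (q^{a-i}-1)/(q^{b-i}-1)
-- computed as (∏ numerators) / (∏ denominators); the division is exact.

divOr0 : ℕ → ℕ → ℕ
divOr0 m zero = 0
divOr0 m (suc d) = m / suc d

gNum : ℕ → ℕ → ℕ → ℕ
gNum q a zero = 1
gNum q a (suc b) = gNum q a b * (q ^ (a ∸ b) ∸ 1)

gDen : ℕ → ℕ → ℕ → ℕ
gDen q c zero = 1
gDen q c (suc b) = gDen q c b * (q ^ (c ∸ b) ∸ 1)

gauss : ℕ → ℕ → ℕ → ℕ
gauss q a b = divOr0 (gNum q a b) (gDen q b b)

geomSum : ℕ → ℕ → ℕ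
geomSum x zero = 0
geomSum x (suc m) = geomSum x m + x ^ m

-- Induction on τ − dim H.  If dim H = τ, the k-spaces through H are at most as many as the
-- (k − h)-spaces of an (n − h)-space.  Otherwise H is not a t-cover of 𝓖, so some G ∈ 𝓖 meets H
-- in dimension d < t, and extending a basis of H ∩ G inside G yields k − t + 1 vectors W of G
-- whose span meets H only in 0.  A member F of 𝓕 through H either meets G in dimension < t (at
-- most s such F) or, as dim (F ∩ G) + (k − t + 1) > dim G, contains a nonzero vector of span W,
-- hence one of its [k−t+1, 1] points p; then F passes through the (h+1)-space H + p, which is
-- handled by induction.
--
-- Dimension theory over the finite field comes from counting: d independent vectors have q^d
-- distinct linear combinations.

{-# OPTIONS --safe #-}
module Submission where

open import Defs
import Level
open import Level using (Level; _⊔_)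
open import Function using (_∘_; id)
open import Data.Nat
  using (ℕ; zero; suc; _+_; _*_; _∸_; _^_; _≤_; _<_; z≤n; s≤s; _≤′_; ≤′-refl; ≤′-step; NonZero; >-nonZero)
import Data.Nat.Properties as ℕ
open import Data.Nat.DivMod using (m*n/n≡m)
open import Data.Nat.Tactic.RingSolver using (solve-∀)
open import Data.Product using (Σ; ∃; ∃₂; _×_; _,_; proj₁; proj₂)
open import Data.Sum using (_⊎_; inj₁; inj₂)
open import Data.Empty using (⊥-elim)
open import Data.List as List using (List; []; _∷_; length; cartesianProductWith)
import Data.List.Properties as List
open import Data.List.Relation.Unary.All as All using (All; []; _∷_)
open import Data.List.Relation.Unary.Any as Any using (Any; here; there; _─_)
open import Data.List.Relation.Unary.AllPairs using ([]; _∷_)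
import Data.List.Relation.Unary.Any.Properties as Any
import Data.List.Relation.Unary.All.Properties as All
import Data.List.Relation.Unary.Unique.Setoid as SetoidUnique
import Data.List.Membership.Setoid as SetoidMembership
open import Data.List.Membership.Propositional using (lose)
open import Relation.Nullary using (¬_; Dec; yes; no; _×-dec_)
import Relation.Nullary.Decidable as Dec
open import Relation.Nullary.Decidable using (¬?; decidable-stable)
open import Data.Unit using (⊤; tt)
open import Relation.Unary using (Pred; _∪_; _⊆_)
open import Relation.Binary.Bundles using (Setoid)
open import Relation.Binary.PropositionalEquality
open import Relation.Binary.Definitions using (DecidableEquality)
open import Data.Vec as Vec using (Vec; []; _∷_; replicate; _++_)
import Data.Vec.Properties as Vec
import Data.Vec.Relation.Unary.All as VecAll
import Data.Vec.Relation.Unary.All.Properties as VecAll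
import Data.List.Membership.Propositional.Properties as MembershipProperties
import Data.List.Relation.Unary.Unique.Propositional.Properties as UniqueProperties
open import Algebra.Bundles using (CommutativeRing; AbelianGroup)
open import Algebra.Structures using (IsCommutativeRing; IsAbelianGroup)
import Algebra.Properties.Ring as RingProperties
import Algebra.Properties.AbelianGroup as AbelianGroupProperties
import Algebra.Properties.CommutativeSemigroup as CommutativeSemigroupProperties

-- Counting up to an equivalence

module Counting {c ℓ : Level} (S : Setoid c ℓ) where
  open Setoid S using (_≈_; _≉_) renaming (Carrier to A; sym to ≈-sym; trans to ≈-trans)
  open SetoidUnique S using (Unique)
  open SetoidMembership S using (_∈_)

  AtMost : ∀ {p} → Pred A p → ℕ → Set (c ⊔ ℓ ⊔ p)
  AtMost P b = ∀ xs → Unique xs → All P xs → length xs ≤ b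

  ∈-─ : ∀ {x y ys} (y∈ys : y ∈ ys) → x ∈ ys → ¬ x ≈ y → x ∈ (ys ─ y∈ys)
  ∈-─ (here y≈z)  (here x≈z)  x≉y = ⊥-elim (x≉y (≈-trans x≈z (≈-sym y≈z)))
  ∈-─ (here _)    (there x∈)  _   = x∈
  ∈-─ (there _)   (here x≈z)  _   = here x≈z
  ∈-─ (there y∈)  (there x∈)  x≉y = there (∈-─ y∈ x∈ x≉y)

  unique-⊆⇒length≤ : ∀ {xs ys} → Unique xs → All (_∈ ys) xs → length xs ≤ length ys
  unique-⊆⇒length≤ [] [] = z≤n
  unique-⊆⇒length≤ {ys = ys} (x≉xs ∷ u) (x∈ys ∷ xs⊆ys) = begin
    suc _                    ≤⟨ s≤s (unique-⊆⇒length≤ u xs⊆ys─x) ⟩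
    suc (length (ys ─ x∈ys)) ≡⟨ List.length-removeAt′ ys (Any.index x∈ys) ⟨
    length ys                ∎
    where
    open ℕ.≤-Reasoning
    xs⊆ys─x = All.zipWith (λ (z≉x , z∈ys) → ∈-─ x∈ys z∈ys (z≉x ∘ ≈-sym)) (x≉xs , xs⊆ys)

  AtMost-⊆-list : ∀ {p} {P : Pred A p} ys → (∀ {x} → P x → x ∈ ys) → AtMost P (length ys)
  AtMost-⊆-list ys P⊆ys xs u pxs = unique-⊆⇒length≤ u (All.map P⊆ys pxs)

  AtMost-mono : ∀ {p q} {P : Pred A p} {Q : Pred A q} {a b} → P ⊆ Q → a ≤ b → AtMost Q a → AtMost P b
  AtMost-mono P⊆Q a≤b boundQ xs u pxs = ℕ.≤-trans (boundQ xs u (All.map P⊆Q pxs)) a≤b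

  partition : ∀ {p q} {P : Pred A p} {Q : Pred A q} {xs} → Unique xs → All (P ∪ Q) xs →
              ∃₂ λ ps qs → length xs ≡ length ps + length qs × (Unique ps × All P ps) × (Unique qs × All Q qs) ×
                           (∀ {y} → All (y ≉_) xs → All (y ≉_) ps × All (y ≉_) qs)
  partition [] [] = [] , [] , refl , ([] , []) , ([] , []) , λ _ → [] , []
  partition {xs = x ∷ _} (x≉xs ∷ u) (inj₁ px ∷ pqs) with partition u pqs
  ... | ps , qs , len , (ups , aps) , uqs , sub =
    x ∷ ps , qs , cong suc len , (proj₁ (sub x≉xs) ∷ ups , px ∷ aps) , uqs ,
    λ { (y≉x ∷ y≉xs) → y≉x ∷ proj₁ (sub y≉xs) , proj₂ (sub y≉xs) }
  partition {xs = x ∷ _} (x≉xs ∷ u) (inj₂ qx ∷ pqs) with partition u pqs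
  ... | ps , qs , len , ups , (uqs , aqs) , sub =
    ps , x ∷ qs , trans (cong suc len) (sym (ℕ.+-suc _ _)) , ups , (proj₂ (sub x≉xs) ∷ uqs , qx ∷ aqs) ,
    λ { (y≉x ∷ y≉xs) → proj₁ (sub y≉xs) , y≉x ∷ proj₂ (sub y≉xs) }

  AtMost-∪ : ∀ {p q} {P : Pred A p} {Q : Pred A q} {a b} → AtMost P a → AtMost Q b → AtMost (P ∪ Q) (a + b)
  AtMost-∪ boundP boundQ xs u pqs with partition u pqs
  ... | ps , qs , len , (ups , aps) , (uqs , aqs) , _ = begin
    length xs             ≡⟨ len ⟩
    length ps + length qs ≤⟨ ℕ.+-mono-≤ (boundP ps ups aps) (boundQ qs uqs aqs) ⟩
    _                     ∎
    where open ℕ.≤-Reasoning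

  AtMost-⋃ : ∀ {i p} {I : Set i} {P : I → Pred A p} {b} (is : List I) →
             All (λ i → AtMost (P i) b) is → AtMost (λ x → Any (λ i → P i x) is) (length is * b)
  AtMost-⋃ [] [] []      _ _          = z≤n
  AtMost-⋃ [] [] (_ ∷ _) _ (() ∷ _)
  AtMost-⋃ (i ∷ is) (bound ∷ bounds) =
    AtMost-mono Any.toSum ℕ.≤-refl (AtMost-∪ bound (AtMost-⋃ is bounds))

module _ {a : Level} {A : Set a} where
  open import Data.List.Relation.Unary.Unique.Propositional using (Unique)
  open import Data.List.Membership.Propositional using (_∈_)

  ≡-dec-in-unique : ∀ {xs : List A} {x y} → Unique xs → x ∈ xs → y ∈ xs → Dec (x ≡ y)
  ≡-dec-in-unique _           (here x≡z)  (here y≡z)  = yes (trans x≡z (sym y≡z))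
  ≡-dec-in-unique (z≢zs ∷ _)  (here x≡z)  (there y∈)  = no λ x≡y → All.lookup z≢zs y∈ (trans (sym x≡z) x≡y)
  ≡-dec-in-unique (z≢zs ∷ _)  (there x∈)  (here y≡z)  = no λ x≡y → All.lookup z≢zs x∈ (trans (sym y≡z) (sym x≡y))
  ≡-dec-in-unique (_ ∷ u)     (there x∈)  (there y∈)  = ≡-dec-in-unique u x∈ y∈

length-cartesianProductWith : ∀ {a b c} {A : Set a} {B : Set b} {C : Set c} (f : A → B → C) xs ys →
                              length (cartesianProductWith f xs ys) ≡ length xs * length ys
length-cartesianProductWith f []       ys = refl
length-cartesianProductWith f (x ∷ xs) ys = begin
  length (List.map (f x) ys List.++ cartesianProductWith f xs ys)
    ≡⟨ List.length-++ (List.map (f x) ys) ⟩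
  length (List.map (f x) ys) + length (cartesianProductWith f xs ys)
    ≡⟨ cong₂ _+_ (List.length-map (f x) ys) (length-cartesianProductWith f xs ys) ⟩
  length ys + length xs * length ys ∎
  where open ≡-Reasoning

length-concatMap-≤ : ∀ {a b} {A : Set a} {B : Set b} (f : A → List B) {m} xs →
                     (∀ x → length (f x) ≤ m) → length (List.concatMap f xs) ≤ length xs * m
length-concatMap-≤ f []       _     = z≤n
length-concatMap-≤ f (x ∷ xs) bound = ℕ.≤-trans (ℕ.≤-reflexive (List.length-++ (f x)))
                                                (ℕ.+-mono-≤ (bound x) (length-concatMap-≤ f xs bound))

++-replicate : ∀ {a} {A : Set a} m {n} (x : A) → replicate m x ++ replicate n x ≡ replicate (m + n) x
++-replicate zero    x = refl
++-replicate (suc m) x = cong (x ∷_) (++-replicate m x)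

^-cancelʳ-≤ : ∀ q {a b} → 1 < q → q ^ a ≤ q ^ b → a ≤ b
^-cancelʳ-≤ q 1<q q^a≤q^b = ℕ.≮⇒≥ λ b<a → ℕ.<⇒≱ (ℕ.^-monoʳ-< q 1<q b<a) q^a≤q^b

-- Gaussian binomials

qBinom : ℕ → ℕ → ℕ → ℕ
qBinom q r       zero    = 1
qBinom q zero    (suc j) = 0
qBinom q (suc r) (suc j) = qBinom q r (suc j) + q ^ (r ∸ j) * qBinom q r j

qBinom-≤-suc : ∀ q r j → qBinom q r j ≤ qBinom q (suc r) j
qBinom-≤-suc q r       zero    = ℕ.≤-refl
qBinom-≤-suc q zero    (suc j) = z≤n
qBinom-≤-suc q (suc r) (suc j) = ℕ.m≤m+n _ _

qBinom-mono-≤ : ∀ q j {r s} → r ≤ s → qBinom q r j ≤ qBinom q s j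
qBinom-mono-≤ q j r≤s = go (ℕ.≤⇒≤′ r≤s)
  where
  go : ∀ {r s} → r ≤′ s → qBinom q r j ≤ qBinom q s j
  go ≤′-refl      = ℕ.≤-refl
  go (≤′-step r≤s) = ℕ.≤-trans (go r≤s) (qBinom-≤-suc q _ j)

qBinom-1≡geomSum : ∀ q a → qBinom q a 1 ≡ geomSum q a
qBinom-1≡geomSum q zero    = refl
qBinom-1≡geomSum q (suc a) = cong₂ _+_ (qBinom-1≡geomSum q a) (ℕ.*-identityʳ (q ^ a))

geomSum-suc : ∀ x m → geomSum x (suc m) ≡ 1 + x * geomSum x m
geomSum-suc x zero    = cong suc (sym (ℕ.*-zeroʳ x))
geomSum-suc x (suc m) = begin
  geomSum x (suc m) + x ^ suc m     ≡⟨ cong (_+ x ^ suc m) (geomSum-suc x m) ⟩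
  1 + x * geomSum x m + x * x ^ m   ≡⟨ cong suc (ℕ.*-distribˡ-+ x _ _) ⟨
  1 + x * (geomSum x m + x ^ m)     ∎
  where open ≡-Reasoning

gDen≡gNum : ∀ q c b → gDen q c b ≡ gNum q c b
gDen≡gNum q c zero    = refl
gDen≡gNum q c (suc b) = cong (_* (q ^ (c ∸ b) ∸ 1)) (gDen≡gNum q c b)

gNum-suc : ∀ q a b → gNum q (suc a) (suc b) ≡ (q ^ suc a ∸ 1) * gNum q a b
gNum-suc q a zero    = ℕ.*-comm 1 _
gNum-suc q a (suc b) = trans (cong (_* (q ^ (a ∸ b) ∸ 1)) (gNum-suc q a b)) (ℕ.*-assoc (q ^ suc a ∸ 1) (gNum q a b) _)

gNum-≡0 : ∀ q {r j} → r < j → gNum q r j ≡ 0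
gNum-≡0 q {r} {suc j} (s≤s r≤j) with ℕ.m≤n⇒m<n∨m≡n r≤j
... | inj₁ r<j  = cong (_* (q ^ (r ∸ j) ∸ 1)) (gNum-≡0 q r<j)
... | inj₂ refl = trans (cong (λ m → gNum q r r * (q ^ m ∸ 1)) (ℕ.n∸n≡0 r)) (ℕ.*-zeroʳ (gNum q r r))

gNum-pos : ∀ q {a b} → 1 < q → b ≤ a → 0 < gNum q a b
gNum-pos q {b = zero}  _   _   = s≤s z≤n
gNum-pos q {a} {suc b} 1<q b<a = ℕ.*-mono-≤ (gNum-pos q 1<q (ℕ.<⇒≤ b<a)) (ℕ.∸-monoˡ-≤ 1 (ℕ.≤-trans 1<q q≤q^[a∸b]))
  where
  q≤q^[a∸b] : q ≤ q ^ (a ∸ b)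
  q≤q^[a∸b] = begin
    q           ≡⟨ ℕ.*-identityʳ q ⟨
    q ^ 1       ≤⟨ ℕ.^-monoʳ-≤ q {{>-nonZero (ℕ.<-trans (s≤s z≤n) 1<q)}} (ℕ.m<n⇒0<n∸m b<a) ⟩
    q ^ (a ∸ b) ∎
    where open ℕ.≤-Reasoning

m∸1+m*[n∸1]≡m*n∸1 : ∀ {m n} → 0 < m → 0 < n → (m ∸ 1) + m * (n ∸ 1) ≡ m * n ∸ 1
m∸1+m*[n∸1]≡m*n∸1 {suc m} {suc n} _ _ = solve-∀′ m n
  where solve-∀′ : ∀ m n → m + suc m * n ≡ n + m * suc n
        solve-∀′ = solve-∀

q^[r∸j]-factor : ∀ q .{{_ : NonZero q}} {r j} → j ≤ r →
                 (q ^ (r ∸ j) ∸ 1) + q ^ (r ∸ j) * (q ^ suc j ∸ 1) ≡ q ^ suc r ∸ 1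
q^[r∸j]-factor q {r} {j} j≤r = begin
  (q ^ (r ∸ j) ∸ 1) + q ^ (r ∸ j) * (q ^ suc j ∸ 1)
    ≡⟨ m∸1+m*[n∸1]≡m*n∸1 (ℕ.m^n>0 q (r ∸ j)) (ℕ.m^n>0 q (suc j)) ⟩
  q ^ (r ∸ j) * q ^ suc j ∸ 1
    ≡⟨ cong (_∸ 1) (ℕ.^-distribˡ-+-* q (r ∸ j) (suc j)) ⟨
  q ^ (r ∸ j + suc j) ∸ 1
    ≡⟨ cong (λ e → q ^ e ∸ 1) (trans (ℕ.+-suc _ j) (cong suc (ℕ.m∸n+n≡m j≤r))) ⟩
  q ^ suc r ∸ 1 ∎
  where open ≡-Reasoning

qBinom-*-gNum : ∀ q .{{_ : NonZero q}} r j → qBinom q r j * gNum q j j ≡ gNum q r j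
qBinom-*-gNum q r       zero    = refl
qBinom-*-gNum q zero    (suc j) = sym (gNum-≡0 q {0} {suc j} (s≤s z≤n))
qBinom-*-gNum q (suc r) (suc j) = begin
  (qBinom q r (suc j) + p * B) * gNum q (suc j) (suc j)
    ≡⟨ ℕ.*-distribʳ-+ (gNum q (suc j) (suc j)) (qBinom q r (suc j)) (p * B) ⟩
  qBinom q r (suc j) * gNum q (suc j) (suc j) + p * B * gNum q (suc j) (suc j)
    ≡⟨ cong₂ _+_ (qBinom-*-gNum q r (suc j)) (cong (p * B *_) (gNum-suc q j j)) ⟩
  gNum q r j * (p ∸ 1) + p * B * ((q ^ suc j ∸ 1) * gNum q j j)
    ≡⟨ cong (gNum q r j * (p ∸ 1) +_) (rearrange p B (q ^ suc j ∸ 1) (gNum q j j)) ⟩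
  gNum q r j * (p ∸ 1) + B * gNum q j j * (p * (q ^ suc j ∸ 1))
    ≡⟨ cong (λ x → gNum q r j * (p ∸ 1) + x * (p * (q ^ suc j ∸ 1))) (qBinom-*-gNum q r j) ⟩
  gNum q r j * (p ∸ 1) + gNum q r j * (p * (q ^ suc j ∸ 1))
    ≡⟨ ℕ.*-distribˡ-+ (gNum q r j) _ _ ⟨
  gNum q r j * ((p ∸ 1) + p * (q ^ suc j ∸ 1))
    ≡⟨ factor ⟩
  gNum q r j * (q ^ suc r ∸ 1)
    ≡⟨ ℕ.*-comm (gNum q r j) _ ⟩
  (q ^ suc r ∸ 1) * gNum q r j
    ≡⟨ gNum-suc q r j ⟨
  gNum q (suc r) (suc j) ∎
  where
  open ≡-Reasoning
  p = q ^ (r ∸ j)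
  B = qBinom q r j
  rearrange : ∀ a b c d → a * b * (c * d) ≡ b * d * (a * c)
  rearrange = solve-∀
  factor : gNum q r j * ((p ∸ 1) + p * (q ^ suc j ∸ 1)) ≡ gNum q r j * (q ^ suc r ∸ 1)
  factor with j ℕ.≤? r
  ... | yes j≤r = cong (gNum q r j *_) (q^[r∸j]-factor q j≤r)
  ... | no  j≰r = trans (cong (_* ((p ∸ 1) + p * (q ^ suc j ∸ 1))) r<j) (sym (cong (_* (q ^ suc r ∸ 1)) r<j))
    where r<j = gNum-≡0 q (ℕ.≰⇒> j≰r)

divOr0-*-cancel : ∀ m d → 0 < d → divOr0 (m * d) d ≡ m
divOr0-*-cancel m (suc d) _ = m*n/n≡m m (suc d)

gauss≡qBinom : ∀ q r j → 1 < q → gauss q r j ≡ qBinom q r j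
gauss≡qBinom q r j 1<q = begin
  divOr0 (gNum q r j) (gDen q j j)                ≡⟨ cong (divOr0 (gNum q r j)) (gDen≡gNum q j j) ⟩
  divOr0 (gNum q r j) (gNum q j j)                ≡⟨ cong (λ m → divOr0 m (gNum q j j)) (qBinom-*-gNum q r j) ⟨
  divOr0 (qBinom q r j * gNum q j j) (gNum q j j) ≡⟨ divOr0-*-cancel _ _ (gNum-pos q {j} 1<q ℕ.≤-refl) ⟩
  qBinom q r j                                    ∎
  where
  open ≡-Reasoning
  instance _ = >-nonZero (ℕ.<-trans (s≤s z≤n) 1<q)

-- Linear algebra over a finite field

module VectorSpace (𝔽 : FiniteField) where
  open FiniteField 𝔽
  open LinAlg 𝔽
  open import Data.List.Relation.Unary.Unique.Propositional using (Unique)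
  open import Data.List.Membership.Propositional using (_∈_)

  private
    variable
      n d e m : ℕ

    module F = IsCommutativeRing isCommutativeRing

    commutativeRing : CommutativeRing Level.zero Level.zero
    commutativeRing = record { isCommutativeRing = isCommutativeRing }

    module F-Ring = RingProperties (CommutativeRing.ring commutativeRing)

  _≟_ : DecidableEquality Carrier
  x ≟ y = ≡-dec-in-unique elements-unique (elements-complete x) (elements-complete y)

  inverseˡ : ∀ a (a≢0 : ¬ a ≡ 0F) → proj₁ (inverse a a≢0) *F a ≡ 1F
  inverseˡ a a≢0 = trans (F.*-comm _ a) (proj₂ (inverse a a≢0))

  -V_ : Vect n → Vect n
  -V_ = Vec.map -F_

  +V-isAbelianGroup : IsAbelianGroup (_≡_ {A = Vect n}) _+V_ zeroV -V_
  +V-isAbelianGroup = record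
    { isGroup = record
      { isMonoid = record
        { isSemigroup = record
          { isMagma = record { isEquivalence = isEquivalence ; ∙-cong = cong₂ _+V_ }
          ; assoc   = Vec.zipWith-assoc F.+-assoc }
        ; identity = Vec.zipWith-identityˡ F.+-identityˡ , Vec.zipWith-identityʳ F.+-identityʳ }
      ; inverse = Vec.zipWith-inverseˡ F.-‿inverseˡ , Vec.zipWith-inverseʳ F.-‿inverseʳ
      ; ⁻¹-cong = cong -V_ }
    ; comm = Vec.zipWith-comm F.+-comm }

  +V-abelianGroup : ℕ → AbelianGroup Level.zero Level.zero
  +V-abelianGroup n = record { isAbelianGroup = +V-isAbelianGroup {n} }

  module +V {n : ℕ} where
    open AbelianGroup (+V-abelianGroup n) public using (assoc; comm; identityˡ; identityʳ; inverseʳ)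
    open AbelianGroupProperties (+V-abelianGroup n) public
    open CommutativeSemigroupProperties (AbelianGroup.commutativeSemigroup (+V-abelianGroup n)) public using (interchange)

  _-V_ : Vect n → Vect n → Vect n
  u -V v = u +V (-V v)

  ·V-distribˡ : ∀ c (u v : Vect n) → c ·V (u +V v) ≡ (c ·V u) +V (c ·V v)
  ·V-distribˡ c []       []       = refl
  ·V-distribˡ c (x ∷ u) (y ∷ v) = cong₂ _∷_ (F.distribˡ c x y) (·V-distribˡ c u v)

  ·V-distribʳ : ∀ a b (v : Vect n) → (a +F b) ·V v ≡ (a ·V v) +V (b ·V v)
  ·V-distribʳ a b []      = refl
  ·V-distribʳ a b (x ∷ v) = cong₂ _∷_ (F.distribʳ x a b) (·V-distribʳ a b v)

  ·V-assoc : ∀ a b (v : Vect n) → (a *F b) ·V v ≡ a ·V (b ·V v)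
  ·V-assoc a b v = trans (Vec.map-cong (F.*-assoc a b) v) (Vec.map-∘ (a *F_) (b *F_) v)

  ·V-identityˡ : ∀ (v : Vect n) → 1F ·V v ≡ v
  ·V-identityˡ v = trans (Vec.map-cong F.*-identityˡ v) (Vec.map-id v)

  ·V-zeroˡ : ∀ (v : Vect n) → 0F ·V v ≡ zeroV
  ·V-zeroˡ v = trans (Vec.map-cong F.zeroˡ v) (Vec.map-const v 0F)

  ·V-zeroʳ : ∀ c → c ·V zeroV {n} ≡ zeroV
  ·V-zeroʳ {n} c = trans (Vec.map-replicate (c *F_) 0F n) (cong (replicate n) (F.zeroʳ c))

  -V≡-1·V : ∀ (v : Vect n) → -V v ≡ (-F 1F) ·V v
  -V≡-1·V v = Vec.map-cong (sym ∘ F-Ring.-1*x≈-x) v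

  ·V-inverse : ∀ {a b} (v : Vect n) → a *F b ≡ 1F → a ·V (b ·V v) ≡ v
  ·V-inverse {a = a} {b} v ab≡1 = trans (sym (·V-assoc a b v)) (trans (cong (_·V v) ab≡1) (·V-identityˡ v))

  linComb-zero : ∀ (bs : Vec (Vect n) d) → linComb zeroV bs ≡ zeroV
  linComb-zero []       = refl
  linComb-zero (b ∷ bs) = trans (cong₂ _+V_ (·V-zeroˡ b) (linComb-zero bs)) (+V.identityˡ zeroV)

  linComb-+ : ∀ (cs ds : Vect d) (bs : Vec (Vect n) d) →
              linComb (cs +V ds) bs ≡ linComb cs bs +V linComb ds bs
  linComb-+ []       []       []       = sym (+V.identityˡ zeroV)
  linComb-+ (c ∷ cs) (d ∷ ds) (b ∷ bs) = begin
    ((c +F d) ·V b) +V linComb (cs +V ds) bs                   ≡⟨ cong₂ _+V_ (·V-distribʳ c d b) (linComb-+ cs ds bs) ⟩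
    ((c ·V b) +V (d ·V b)) +V (linComb cs bs +V linComb ds bs) ≡⟨ +V.interchange _ _ _ _ ⟩
    ((c ·V b) +V linComb cs bs) +V ((d ·V b) +V linComb ds bs) ∎
    where open ≡-Reasoning

  linComb-· : ∀ a (cs : Vect d) (bs : Vec (Vect n) d) → linComb (a ·V cs) bs ≡ a ·V linComb cs bs
  linComb-· a []       []       = sym (·V-zeroʳ a)
  linComb-· a (c ∷ cs) (b ∷ bs) = begin
    ((a *F c) ·V b) +V linComb (a ·V cs) bs  ≡⟨ cong₂ _+V_ (·V-assoc a c b) (linComb-· a cs bs) ⟩
    (a ·V (c ·V b)) +V (a ·V linComb cs bs)  ≡⟨ ·V-distribˡ a _ _ ⟨
    a ·V ((c ·V b) +V linComb cs bs)         ∎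
    where open ≡-Reasoning

  linComb--V : ∀ (cs : Vect d) (bs : Vec (Vect n) d) → linComb (-V cs) bs ≡ -V linComb cs bs
  linComb--V cs bs = begin
    linComb (-V cs) bs            ≡⟨ cong (λ x → linComb x bs) (-V≡-1·V cs) ⟩
    linComb ((-F 1F) ·V cs) bs    ≡⟨ linComb-· (-F 1F) cs bs ⟩
    (-F 1F) ·V linComb cs bs      ≡⟨ -V≡-1·V _ ⟨
    -V linComb cs bs              ∎
    where open ≡-Reasoning

  linComb-− : ∀ (cs ds : Vect d) (bs : Vec (Vect n) d) →
              linComb (cs -V ds) bs ≡ linComb cs bs -V linComb ds bs
  linComb-− cs ds bs = trans (linComb-+ cs (-V ds) bs) (cong (linComb cs bs +V_) (linComb--V ds bs))

  linComb-++ : ∀ (cs : Vect d) (ds : Vect e) (bs : Vec (Vect n) d) (es : Vec (Vect n) e) →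
               linComb (cs ++ ds) (bs ++ es) ≡ linComb cs bs +V linComb ds es
  linComb-++ []       ds []       es = sym (+V.identityˡ _)
  linComb-++ (c ∷ cs) ds (b ∷ bs) es = trans (cong ((c ·V b) +V_) (linComb-++ cs ds bs es)) (sym (+V.assoc _ _ _))

  ∋-linComb : ∀ (S : Subspace n) (cs : Vect d) {bs} → VecAll.All (S ∋_) bs → S ∋ linComb cs bs
  ∋-linComb S []       VecAll.[]         = zero∈ S
  ∋-linComb S (c ∷ cs) (b∈S VecAll.∷ bs∈S) = +∈ S (·∈ S c b∈S) (∋-linComb S cs bs∈S)

  ∋--V : ∀ (S : Subspace n) {v} → S ∋ v → S ∋ (-V v)
  ∋--V S {v} v∈S = subst (S ∋_) (sym (-V≡-1·V v)) (·∈ S (-F 1F) v∈S)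

  ∋-− : ∀ (S : Subspace n) {u v} → S ∋ u → S ∋ v → S ∋ (u -V v)
  ∋-− S u∈S v∈S = +∈ S u∈S (∋--V S v∈S)

  ∋-+-cancelʳ : ∀ (S : Subspace n) {e u} → S ∋ (e +V u) → S ∋ u → S ∋ e
  ∋-+-cancelʳ S {e} {u} e+u∈S u∈S = subst (S ∋_) (+V.//-rightDividesʳ u e) (∋-− S e+u∈S u∈S)

  span : Vec (Vect n) d → Subspace n
  span bs = record
    { _∋_   = InSpan bs
    ; zero∈ = zeroV , linComb-zero bs
    ; +∈    = λ { (cs , refl) (ds , refl) → cs +V ds , linComb-+ cs ds bs }
    ; ·∈    = λ { a (cs , refl) → a ·V cs , linComb-· a cs bs }
    }

  span-⊆ : ∀ (S : Subspace n) {bs : Vec (Vect n) d} → VecAll.All (S ∋_) bs → span bs ⊆S S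
  span-⊆ S bs∈S v (cs , refl) = ∋-linComb S cs bs∈S

  InSpan-∷ : ∀ w {bs : Vec (Vect n) d} {v} → InSpan bs v → InSpan (w ∷ bs) v
  InSpan-∷ w (cs , refl) = 0F ∷ cs , trans (cong (_+V _) (·V-zeroˡ w)) (+V.identityˡ _)

  InSpan-head : ∀ w (bs : Vec (Vect n) d) → InSpan (w ∷ bs) w
  InSpan-head w bs = 1F ∷ zeroV , trans (cong₂ _+V_ (·V-identityˡ w) (linComb-zero bs)) (+V.identityʳ w)

  InSpan-self : ∀ (bs : Vec (Vect n) d) → VecAll.All (InSpan bs) bs
  InSpan-self []       = VecAll.[]
  InSpan-self (b ∷ bs) = InSpan-head b bs VecAll.∷ VecAll.map (InSpan-∷ b) (InSpan-self bs)

  InSpan-++ʳ : ∀ (X : Vec (Vect n) e) {bs : Vec (Vect n) d} {v} → InSpan bs v → InSpan (X ++ bs) v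
  InSpan-++ʳ X {bs} (cs , refl) =
    zeroV ++ cs , trans (linComb-++ zeroV cs X bs) (trans (cong (_+V _) (linComb-zero X)) (+V.identityˡ _))

  InSpan-++⁻ : ∀ (R : Vec (Vect n) e) (bs : Vec (Vect n) d) {v} → InSpan (R ++ bs) v →
               ∃₂ λ a b → linComb a R +V linComb b bs ≡ v
  InSpan-++⁻ {e = e} R bs (cs , refl) with Vec.splitAt e cs
  ... | a , b , refl = a , b , sym (linComb-++ a b R bs)

  HasDim-basis-∈ : ∀ {W : Subspace n} → ((bs , _) : HasDim W d) → VecAll.All (W ∋_) bs
  HasDim-basis-∈ (bs , _ , W⇔span) = VecAll.map (λ {v} → proj₂ (W⇔span v)) (InSpan-self bs)

  vectors : (d : ℕ) → List (Vect d)
  vectors zero    = [] ∷ []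
  vectors (suc d) = cartesianProductWith _∷_ elements (vectors d)

  ∈-vectors : ∀ (v : Vect d) → v ∈ vectors d
  ∈-vectors []      = here refl
  ∈-vectors (x ∷ v) = MembershipProperties.∈-cartesianProductWith⁺ _∷_ (elements-complete x) (∈-vectors v)

  vectors-unique : ∀ d → Unique (vectors d)
  vectors-unique zero    = [] ∷ []
  vectors-unique (suc d) = UniqueProperties.cartesianProductWith⁺ _∷_ Vec.∷-injective elements-unique (vectors-unique d)

  length-vectors : ∀ d → length (vectors d) ≡ size ^ d
  length-vectors zero    = refl
  length-vectors (suc d) = trans (length-cartesianProductWith _∷_ elements (vectors d)) (cong (size *_) (length-vectors d))

  ∃-vector? : ∀ {p} {P : Vect d → Set p} → (∀ v → Dec (P v)) → Dec (∃ P)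
  ∃-vector? P? with Any.any? P? (vectors _)
  ... | yes p = yes (Any.satisfied p)
  ... | no ¬p = no λ (v , pv) → ¬p (lose (∈-vectors v) pv)

  InSpan? : ∀ (bs : Vec (Vect n) d) v → Dec (InSpan bs v)
  InSpan? bs v = ∃-vector? (λ cs → Vec.≡-dec _≟_ (linComb cs bs) v)

  1<size : 1 < size
  1<size = Counting.unique-⊆⇒length≤ (setoid Carrier) ((0≢1 ∷ []) ∷ [] ∷ [])
                                       (elements-complete 0F ∷ elements-complete 1F ∷ [])

  LinIndep-[] : LinIndep {n} []
  LinIndep-[] [] _ = refl

  linComb-injective : ∀ {bs : Vec (Vect n) d} → LinIndep bs → ∀ {cs ds} → linComb cs bs ≡ linComb ds bs → cs ≡ ds
  linComb-injective {bs = bs} indep {cs} {ds} eq = +V.x∙y⁻¹≈ε⇒x≈y cs ds (indep (cs -V ds) (begin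
    linComb (cs -V ds) bs          ≡⟨ linComb-− cs ds bs ⟩
    linComb cs bs -V linComb ds bs ≡⟨ +V.x≈y⇒x∙y⁻¹≈ε eq ⟩
    zeroV                          ∎))
    where open ≡-Reasoning

  LinIndep-∷ : ∀ {v} {bs : Vec (Vect n) d} → LinIndep bs → ¬ InSpan bs v → LinIndep (v ∷ bs)
  LinIndep-∷ {v = v} {bs} indep v∉bs (c ∷ cs) eq with c ≟ 0F
  ... | yes refl = cong (0F ∷_) (indep cs (trans (sym (+V.identityˡ _)) (trans (cong (_+V _) (sym (·V-zeroˡ v))) eq)))
  ... | no  c≢0  = ⊥-elim (v∉bs (subst (InSpan bs) (·V-inverse v (inverseˡ c c≢0))
                                                       (·∈ (span bs) c⁻¹ cv∈bs)))
    where
    c⁻¹ = proj₁ (inverse c c≢0)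
    cv∈bs : InSpan bs (c ·V v)
    cv∈bs = subst (InSpan bs) (sym (+V.inverseˡ-unique _ _ eq)) (∋--V (span bs) (cs , refl))

  LinIndep-∷⁻ : ∀ {v} {bs : Vec (Vect n) d} → LinIndep (v ∷ bs) → ¬ InSpan bs v
  LinIndep-∷⁻ {v = v} {bs} indep (cs , v≡) =
    0≢1 (sym (Vec.∷-injectiveˡ (linComb-injective indep {1F ∷ zeroV} {0F ∷ cs} (begin
      (1F ·V v) +V linComb zeroV bs  ≡⟨ cong₂ _+V_ (·V-identityˡ v) (linComb-zero bs) ⟩
      v +V zeroV                     ≡⟨ +V.identityʳ v ⟩
      v                              ≡⟨ v≡ ⟨
      linComb cs bs                  ≡⟨ +V.identityˡ _ ⟨
      zeroV +V linComb cs bs         ≡⟨ cong (_+V _) (·V-zeroˡ v) ⟨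
      (0F ·V v) +V linComb cs bs     ∎))))
    where open ≡-Reasoning

  LinIndep-++-disjoint : ∀ {R : Vec (Vect n) e} {bs : Vec (Vect n) d} → LinIndep (R ++ bs) →
                         ∀ {a b} → linComb a R ≡ linComb b bs → a ≡ zeroV × b ≡ zeroV
  LinIndep-++-disjoint {R = R} {bs} indep {a} {b} eq =
    Vec.++-injectiveˡ a zeroV a++0≡0++b , sym (Vec.++-injectiveʳ a zeroV a++0≡0++b)
    where
    open ≡-Reasoning
    a++0≡0++b : a ++ zeroV ≡ zeroV ++ b
    a++0≡0++b = linComb-injective indep (begin
      linComb (a ++ zeroV) (R ++ bs)   ≡⟨ linComb-++ a zeroV R bs ⟩
      linComb a R +V linComb zeroV bs  ≡⟨ cong₂ _+V_ eq (linComb-zero bs) ⟩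
      linComb b bs +V zeroV            ≡⟨ +V.comm _ _ ⟩
      zeroV +V linComb b bs            ≡⟨ cong (_+V _) (linComb-zero R) ⟨
      linComb zeroV R +V linComb b bs  ≡⟨ linComb-++ zeroV b R bs ⟨
      linComb (zeroV ++ b) (R ++ bs)   ∎)

  LinIndep-++⁻ʳ : ∀ {R : Vec (Vect n) e} {bs : Vec (Vect n) d} → LinIndep (R ++ bs) → LinIndep bs
  LinIndep-++⁻ʳ {R = R} indep b eq = proj₂ (LinIndep-++-disjoint indep {a = zeroV} (trans (linComb-zero R) (sym eq)))

  LinIndep⇒size^≤ : ∀ {xs : Vec (Vect n) d} → LinIndep xs → (ys : List (Vect n)) →
                    (∀ cs → linComb cs xs ∈ ys) → size ^ d ≤ length ys
  LinIndep⇒size^≤ {n = n} {d = d} {xs} indep ys ys∋ = begin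
    size ^ d                                              ≡⟨ length-vectors d ⟨
    length (vectors d)                                    ≡⟨ List.length-map (λ cs → linComb cs xs) (vectors d) ⟨
    length (List.map (λ cs → linComb cs xs) (vectors d))  ≤⟨ Counting.unique-⊆⇒length≤ (setoid (Vect n))
                                                               (UniqueProperties.map⁺ (linComb-injective indep) (vectors-unique d))
                                                               (All.map⁺ (All.tabulate λ {cs} _ → ys∋ cs)) ⟩
    length ys                                             ∎
    where open ℕ.≤-Reasoning

  -- The size ^ d combinations of xs are distinct and lie among the size ^ e combinations of ys.
  LinIndep-≤-span : ∀ {xs : Vec (Vect n) d} {ys : Vec (Vect n) e} → LinIndep xs → VecAll.All (InSpan ys) xs → d ≤ e
  LinIndep-≤-span {d = d} {e} {xs} {ys} indep xs⊆ys = ^-cancelʳ-≤ size 1<size (begin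
    size ^ d                                              ≤⟨ LinIndep⇒size^≤ indep _ ∈-combinations ⟩
    length (List.map (λ cs → linComb cs ys) (vectors e))  ≡⟨ List.length-map (λ cs → linComb cs ys) (vectors e) ⟩
    length (vectors e)                                    ≡⟨ length-vectors e ⟩
    size ^ e                                              ∎)
    where
    open ℕ.≤-Reasoning
    ∈-combinations : ∀ cs → linComb cs xs ∈ List.map (λ cs → linComb cs ys) (vectors e)
    ∈-combinations cs with ∋-linComb (span ys) cs xs⊆ys
    ... | ds , eq = subst (_∈ _) eq (MembershipProperties.∈-map⁺ (λ cs → linComb cs ys) (∈-vectors ds))

  LinIndep-≤-dim : ∀ {xs : Vec (Vect n) d} → LinIndep xs → d ≤ n
  LinIndep-≤-dim {n = n} {d} indep = ^-cancelʳ-≤ size 1<size (begin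
    size ^ d            ≤⟨ LinIndep⇒size^≤ indep (vectors n) (λ cs → ∈-vectors _) ⟩
    length (vectors n)  ≡⟨ length-vectors n ⟩
    size ^ n            ∎)
    where open ℕ.≤-Reasoning

  record Extension (S : Subspace n) (bs : Vec (Vect n) d) (vs : List (Vect n)) : Set where
    field
      {extra}     : ℕ
      ext         : Vec (Vect n) extra
      independent : LinIndep (ext ++ bs)
      ext⊆S       : VecAll.All (S ∋_) ext
      spans       : All (λ v → S ∋ v → InSpan (ext ++ bs) v) vs

  extend : ∀ {S : Subspace n} {bs : Vec (Vect n) d} → (∀ v → Dec (S ∋ v)) → LinIndep bs → ∀ vs → Extension S bs vs
  extend S? indep [] = record { ext = [] ; independent = indep ; ext⊆S = VecAll.[] ; spans = [] }
  extend {S = S} {bs} S? indep (v ∷ vs) with extend {S = S} S? indep vs | S? v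
  ... | E | no v∉S = record { Extension E hiding (spans) ; spans = (λ v∈S → ⊥-elim (v∉S v∈S)) ∷ Extension.spans E }
  ... | E | yes v∈S with InSpan? (Extension.ext E ++ bs) v
  ...   | yes v∈span = record { Extension E hiding (spans) ; spans = (λ _ → v∈span) ∷ Extension.spans E }
  ...   | no  v∉span = record
    { ext         = v ∷ ext
    ; independent = LinIndep-∷ independent v∉span
    ; ext⊆S       = v∈S VecAll.∷ ext⊆S
    ; spans       = (λ _ → InSpan-head v _) ∷ All.map (λ covered v∈S → InSpan-∷ v (covered v∈S)) spans
    }
    where open Extension E

  BasisExtension : Subspace n → Vec (Vect n) d → Set
  BasisExtension S bs = Extension S bs (vectors _)

  extendToBasis : ∀ {S : Subspace n} {bs : Vec (Vect n) d} → (∀ v → Dec (S ∋ v)) → LinIndep bs → BasisExtension S bs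
  extendToBasis {S = S} S? indep = extend {S = S} S? indep (vectors _)

  BasisExtension-spans : ∀ {S : Subspace n} {bs : Vec (Vect n) d} (E : BasisExtension S bs) →
                         S ⊆S span (Extension.ext E ++ bs)
  BasisExtension-spans E v = All.lookup (Extension.spans E) (∈-vectors v)

  BasisExtension-HasDim : ∀ {S : Subspace n} {bs : Vec (Vect n) d} → VecAll.All (S ∋_) bs →
                          (E : BasisExtension S bs) → HasDim S (Extension.extra E + d)
  BasisExtension-HasDim {S = S} bs∈S E =
    ext ++ _ , independent , λ v → BasisExtension-spans E v , span-⊆ S (VecAll.++⁺ ext⊆S bs∈S) v
    where open Extension E

  dimension : ∀ {S : Subspace n} → (∀ v → Dec (S ∋ v)) → ∃ (HasDim S)
  dimension {S = S} S? = _ , subst (HasDim S) (ℕ.+-identityʳ _) (BasisExtension-HasDim VecAll.[] (extendToBasis {S = S} S? LinIndep-[]))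

  HasDim-unique : ∀ {S : Subspace n} → HasDim S d → HasDim S e → d ≡ e
  HasDim-unique (bs , bs-indep , S⇔bs) (cs , cs-indep , S⇔cs) = ℕ.≤-antisym
    (LinIndep-≤-span bs-indep (VecAll.map (λ {v} v∈bs → proj₁ (S⇔cs v) (proj₂ (S⇔bs v) v∈bs)) (InSpan-self bs)))
    (LinIndep-≤-span cs-indep (VecAll.map (λ {v} v∈cs → proj₁ (S⇔bs v) (proj₂ (S⇔cs v) v∈cs)) (InSpan-self cs)))

  HasDim-∋? : ∀ {S : Subspace n} → HasDim S d → ∀ v → Dec (S ∋ v)
  HasDim-∋? (bs , _ , S⇔bs) v = Dec.map′ (proj₂ (S⇔bs v)) (proj₁ (S⇔bs v)) (InSpan? bs v)

  ∩S-∋? : ∀ {S T : Subspace n} → (∀ v → Dec (S ∋ v)) → (∀ v → Dec (T ∋ v)) → ∀ v → Dec ((S ∩S T) ∋ v)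
  ∩S-∋? S? T? v = S? v ×-dec T? v

  HasDim-≐-span : ∀ {S : Subspace n} → HasDim S d → {bs : Vec (Vect n) d} →
                  LinIndep bs → VecAll.All (S ∋_) bs → S ≐ span bs
  HasDim-≐-span {d = d} {S} (cs , _ , S⇔cs) {bs} indep bs∈S v = S⊆bs , span-⊆ S bs∈S v
    where
    S⊆bs : S ∋ v → InSpan bs v
    S⊆bs v∈S with InSpan? bs v
    ... | yes v∈bs = v∈bs
    ... | no  v∉bs = ⊥-elim (ℕ.<-irrefl refl (LinIndep-≤-span (LinIndep-∷ indep v∉bs)
                                              (VecAll.map (λ {u} → proj₁ (S⇔cs u)) (v∈S VecAll.∷ bs∈S))))

  ≐-setoid : ℕ → Setoid (Level.suc Level.zero) Level.zero
  ≐-setoid n = record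
    { Carrier       = Subspace n
    ; _≈_           = _≐_
    ; isEquivalence = record
      { refl  = λ v → id , id
      ; sym   = λ U≐W v → proj₂ (U≐W v) , proj₁ (U≐W v)
      ; trans = λ U≐W W≐Z v → proj₁ (W≐Z v) ∘ proj₁ (U≐W v) , proj₂ (U≐W v) ∘ proj₂ (W≐Z v)
      }
    }

  ∩S-dimension : ∀ {S T : Subspace n} → HasDim S d → HasDim T e → ∃ (HasDim (S ∩S T))
  ∩S-dimension {S = S} {T} hdS hdT = dimension {S = S ∩S T} (∩S-∋? {S = S} {T} (HasDim-∋? {S = S} hdS) (HasDim-∋? {S = T} hdT))

  ⊤S : Subspace n
  ⊤S = record { _∋_ = λ _ → ⊤ ; zero∈ = tt ; +∈ = λ _ _ → tt ; ·∈ = λ _ _ → tt }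

  LinIndep-or-dependency : ∀ (bs : Vec (Vect n) d) → LinIndep bs ⊎ ∃ λ cs → ¬ cs ≡ zeroV × linComb cs bs ≡ zeroV
  LinIndep-or-dependency bs with ∃-vector? (λ cs → ¬? (Vec.≡-dec _≟_ cs zeroV) ×-dec Vec.≡-dec _≟_ (linComb cs bs) zeroV)
  ... | yes dependency  = inj₂ dependency
  ... | no  ¬dependency = inj₁ λ cs eq → decidable-stable (Vec.≡-dec _≟_ cs zeroV) λ cs≢0 → ¬dependency (cs , cs≢0 , eq)

  LinIndep-++-trim : ∀ {P : Vect n → Set} {bs : Vec (Vect n) d} {w m} → w ≤′ m → (R : Vec (Vect n) m) →
                     LinIndep (R ++ bs) → VecAll.All P R → ∃ λ (W : Vec (Vect n) w) → LinIndep (W ++ bs) × VecAll.All P W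
  LinIndep-++-trim ≤′-refl        R       indep R∈P                = R , indep , R∈P
  LinIndep-++-trim (≤′-step w≤m) (x ∷ R) indep (_ VecAll.∷ R∈P) =
    LinIndep-++-trim w≤m R (LinIndep-++⁻ʳ {R = x ∷ []} indep) R∈P

  spans-meet : ∀ {as : Vec (Vect n) d} {bs : Vec (Vect n) e} {gs : Vec (Vect n) m} →
               LinIndep as → VecAll.All (InSpan gs) as → VecAll.All (InSpan gs) bs → m < d + e →
               ∃ λ cs → ¬ cs ≡ zeroV × InSpan as (linComb cs bs)
  spans-meet {d = d} {as = as} {bs} as-indep as⊆gs bs⊆gs m<d+e with LinIndep-or-dependency (as ++ bs)
  ... | inj₁ indep = ⊥-elim (ℕ.<⇒≱ m<d+e (LinIndep-≤-span indep (VecAll.++⁺ as⊆gs bs⊆gs)))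
  ... | inj₂ (cs , cs≢0 , cs-dep) with Vec.splitAt d cs
  ...   | ca , cb , refl = cb , cb≢0 , -V ca , ca-term≡
    where
    sum≡0 : linComb ca as +V linComb cb bs ≡ zeroV
    sum≡0 = trans (sym (linComb-++ ca cb as bs)) cs-dep
    cb≢0 : ¬ cb ≡ zeroV
    cb≢0 refl = cs≢0 (trans (cong (_++ zeroV) ca≡0) (++-replicate d 0F))
      where ca≡0 = as-indep ca (trans (sym (+V.identityʳ _)) (trans (cong (_ +V_) (sym (linComb-zero bs))) sum≡0))
    ca-term≡ : linComb (-V ca) as ≡ linComb cb bs
    ca-term≡ = begin
      linComb (-V ca) as  ≡⟨ linComb--V ca as ⟩
      -V linComb ca as    ≡⟨ +V.inverseʳ-unique _ _ sum≡0 ⟨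
      linComb cb bs       ∎
      where open ≡-Reasoning

  ≐-span-∷ : ∀ {F : Subspace n} {w} {Xh : Vec (Vect n) m} {Eb : Vec (Vect n) d} →
             F ⊆S span (w ∷ Xh) → (F ∩S span Xh) ≐ span Eb → F ∋ w → F ≐ span (w ∷ Eb)
  ≐-span-∷ {F = F} {w} {Xh} {Eb} F⊆w∷Xh F∩Xh≐Eb w∈F v = F⊆w∷Eb , span-⊆ F (w∈F VecAll.∷ Eb⊆F) v
    where
    Eb⊆F : VecAll.All (F ∋_) Eb
    Eb⊆F = VecAll.map (λ {u} u∈Eb → proj₁ (proj₂ (F∩Xh≐Eb u) u∈Eb)) (InSpan-self Eb)
    F⊆w∷Eb : F ∋ v → InSpan (w ∷ Eb) v
    F⊆w∷Eb v∈F with F⊆w∷Xh v v∈F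
    ... | b ∷ cs , refl with proj₁ (F∩Xh≐Eb (linComb cs Xh))
                                   (subst (F ∋_) (+V.xyx⁻¹≈y (b ·V w) _) (∋-− F v∈F (·∈ F b w∈F)) , cs , refl)
    ...   | ds , Eb-part = b ∷ ds , cong ((b ·V w) +V_) Eb-part

  span-∷-shift : ∀ {e u} {Xh : Vec (Vect n) m} → InSpan Xh u → span (e ∷ Xh) ⊆S span ((e +V u) ∷ Xh)
  span-∷-shift {e = e} {u} {Xh} u∈Xh = span-⊆ (span ((e +V u) ∷ Xh)) (e∈ VecAll.∷ VecAll.map (InSpan-∷ _) (InSpan-self Xh))
    where
    e∈ : InSpan ((e +V u) ∷ Xh) e
    e∈ = subst (InSpan _) (+V.//-rightDividesʳ u e) (∋-− (span _) (InSpan-head (e +V u) Xh) (InSpan-∷ _ u∈Xh))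

  InSpan-∷-rescale : ∀ {e f} {Xh : Vec (Vect n) m} → InSpan (e ∷ Xh) f → ¬ InSpan Xh f →
              ∃₂ λ c u → InSpan Xh u × c ·V f ≡ e +V u
  InSpan-∷-rescale {e = e} {Xh = Xh} (a ∷ cs , refl) f∉Xh with a ≟ 0F
  ... | yes refl = ⊥-elim (f∉Xh (cs , sym (trans (cong (_+V _) (·V-zeroˡ e)) (+V.identityˡ _))))
  ... | no  a≢0  = a⁻¹ , a⁻¹ ·V linComb cs Xh , ·∈ (span Xh) a⁻¹ (cs , refl) , (begin
      a⁻¹ ·V ((a ·V e) +V linComb cs Xh)          ≡⟨ ·V-distribˡ a⁻¹ _ _ ⟩
      (a⁻¹ ·V (a ·V e)) +V (a⁻¹ ·V linComb cs Xh) ≡⟨ cong (_+V (a⁻¹ ·V linComb cs Xh)) (·V-inverse e (inverseˡ a a≢0)) ⟩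
      e +V (a⁻¹ ·V linComb cs Xh)                 ∎)
    where
    open ≡-Reasoning
    a⁻¹ = proj₁ (inverse a a≢0)

  -- One vector per 1-dimensional subspace of 𝔽^d: those whose first nonzero entry is 1.
  points : (d : ℕ) → List (Vect d)
  points zero    = []
  points (suc d) = List.map (1F ∷_) (vectors d) List.++ List.map (0F ∷_) (points d)

  length-points : ∀ d → length (points d) ≡ geomSum size d
  length-points zero    = refl
  length-points (suc d) = begin
    length (List.map (1F ∷_) (vectors d) List.++ List.map (0F ∷_) (points d))
      ≡⟨ List.length-++ (List.map (1F ∷_) (vectors d)) ⟩
    length (List.map (1F ∷_) (vectors d)) + length (List.map (0F ∷_) (points d))
      ≡⟨ cong₂ _+_ (List.length-map _ (vectors d)) (List.length-map _ (points d)) ⟩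
    length (vectors d) + length (points d)
      ≡⟨ cong₂ _+_ (length-vectors d) (length-points d) ⟩
    size ^ d + geomSum size d
      ≡⟨ ℕ.+-comm (size ^ d) _ ⟩
    geomSum size (suc d) ∎
    where open ≡-Reasoning

  points-nonzero : ∀ d → All (λ p → ¬ p ≡ zeroV) (points d)
  points-nonzero zero    = []
  points-nonzero (suc d) = All.++⁺ (All.map⁺ (All.tabulate λ _ eq → 0≢1 (sym (Vec.∷-injectiveˡ eq))))
                                   (All.map⁺ (All.map (λ p≢0 eq → p≢0 (Vec.∷-injectiveʳ eq)) (points-nonzero d)))

  points-cover : ∀ {c : Vect d} → ¬ c ≡ zeroV → Any (λ p → ∃ λ l → l ·V c ≡ p) (points d)
  points-cover {c = []}     c≢0 = ⊥-elim (c≢0 refl)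
  points-cover {c = a ∷ cs} c≢0 with a ≟ 0F
  ... | yes refl = Any.++⁺ʳ _ (Any.map⁺ (Any.map (λ (l , lcs≡p) → l , cong₂ _∷_ (F.zeroʳ l) lcs≡p)
                                                 (points-cover λ cs≡0 → c≢0 (cong (0F ∷_) cs≡0))))
  ... | no  a≢0  = Any.++⁺ˡ (Any.map⁺ (lose (∈-vectors (a⁻¹ ·V cs)) (a⁻¹ , cong (_∷ (a⁻¹ ·V cs)) (inverseˡ a a≢0))))
    where a⁻¹ = proj₁ (inverse a a≢0)

-- Counting the subspaces through a fixed subspace

module SubspacesThrough (𝔽 : FiniteField) {n h : ℕ} (hb : Vec (LinAlg.Vect 𝔽 n) h) where
  open FiniteField 𝔽
  open LinAlg 𝔽
  open VectorSpace 𝔽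

  record Candidate {r} (X : Vec (Vect n) r) (j : ℕ) : Set where
    constructor candidate
    field
      basis       : Vec (Vect n) (j + h)
      independent : LinIndep basis
      ⊆X          : VecAll.All (InSpan (X ++ hb)) basis

  open Candidate

  Between : ∀ {r} → Vec (Vect n) r → ℕ → Subspace n → Set
  Between X j F = HasDim F (j + h) × VecAll.All (F ∋_) hb × F ⊆S span (X ++ hb)

  Covers : ∀ {r} (X : Vec (Vect n) r) j → List (Candidate X j) → Set₁
  Covers X j C = ∀ F → Between X j F → Any (λ c → F ≐ span (basis c)) C

  record Candidates {r} (X : Vec (Vect n) r) (j : ℕ) : Set₁ where
    field
      list    : List (Candidate X j)
      length≤ : length list ≤ qBinom size r j
      covers  : Covers X j list

  module Step {r : ℕ} (e : Vect n) (X : Vec (Vect n) r) (e∉X : ¬ InSpan (X ++ hb) e) where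

    private
      Xh = X ++ hb

    lift : ∀ {j} → Candidate X j → Candidate (e ∷ X) j
    lift c = candidate (basis c) (independent c) (VecAll.map (InSpan-∷ e) (⊆X c))

    basisExtension : ∀ {j} (c : Candidate X j) → BasisExtension (span Xh) (basis c)
    basisExtension c = extendToBasis {S = span Xh} (InSpan? Xh) (independent c)

    module _ {j : ℕ} (c : Candidate X j) where
      open Extension (basisExtension c) using (extra; ext; ext⊆S)

      extension : Vect extra → Candidate (e ∷ X) (suc j)
      extension cR = candidate (e +V linComb cR ext ∷ basis c) (LinIndep-∷ (independent c) w∉c)
                               (w∈ VecAll.∷ VecAll.map (InSpan-∷ e) (⊆X c))
        where
        ext-part∈X : InSpan Xh (linComb cR ext)
        ext-part∈X = ∋-linComb (span Xh) cR ext⊆S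
        w∉c : ¬ InSpan (basis c) (e +V linComb cR ext)
        w∉c w∈c = e∉X (∋-+-cancelʳ (span Xh) (span-⊆ (span Xh) (⊆X c) _ w∈c) ext-part∈X)
        w∈ : InSpan (e ∷ Xh) (e +V linComb cR ext)
        w∈ = +∈ (span (e ∷ Xh)) (InSpan-head e _) (InSpan-∷ e ext-part∈X)
      extensions : List (Candidate (e ∷ X) (suc j))
      extensions = List.map extension (vectors extra)

      length-extensions : length extensions ≤ size ^ (r ∸ j)
      length-extensions = begin
        length extensions  ≡⟨ List.length-map extension (vectors extra) ⟩
        length (vectors extra)  ≡⟨ length-vectors extra ⟩
        size ^ extra  ≤⟨ ℕ.^-monoʳ-≤ size {{>-nonZero (ℕ.<-trans (s≤s z≤n) 1<size)}} extra≤r∸j ⟩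
        size ^ (r ∸ j)  ∎
        where
        open ℕ.≤-Reasoning
        extra≤r∸j : extra ≤ r ∸ j
        extra≤r∸j = ℕ.m+n≤o⇒m≤o∸n extra (ℕ.+-cancelʳ-≤ h _ _ (subst (_≤ r + h) (sym (ℕ.+-assoc extra j h))
                      (LinIndep-≤-span (Extension.independent (basisExtension c)) (VecAll.++⁺ ext⊆S (⊆X c)))))

    module _ {j : ℕ} {F : Subspace n} (F-between : Between (e ∷ X) (suc j) F)
             {w₀ u : Vect n} (w₀∈F : F ∋ w₀) (u∈X : InSpan Xh u) (w₀≡e+u : w₀ ≡ e +V u) where
      private
        hdF = proj₁ F-between
        F⊆e∷X = proj₂ (proj₂ F-between)

      section-between : Between X j (F ∩S span Xh)
      section-between with dimension {S = F ∩S span Xh} (∩S-∋? {S = F} {T = span Xh} (HasDim-∋? {S = F} hdF) (InSpan? Xh))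
      ... | d , hd@(eb , eb-indep , F∩X≐eb) = subst (HasDim (F ∩S span Xh)) d≡j+h hd , hb⊆F∩X , λ _ → proj₂
        where
        hb⊆F∩X = VecAll.zip (proj₁ (proj₂ F-between) , VecAll.map (InSpan-++ʳ X) (InSpan-self hb))
        w₀∉eb : ¬ InSpan eb w₀
        w₀∉eb w₀∈eb = e∉X (∋-+-cancelʳ (span Xh) (subst (InSpan Xh) w₀≡e+u (proj₂ (proj₂ (F∩X≐eb w₀) w₀∈eb))) u∈X)
        F⊆w₀∷X : F ⊆S span (w₀ ∷ Xh)
        F⊆w₀∷X v v∈F = subst (λ w → InSpan (w ∷ Xh) v) (sym w₀≡e+u) (span-∷-shift u∈X v (F⊆e∷X v v∈F))
        d≡j+h : d ≡ j + h
        d≡j+h = ℕ.suc-injective (HasDim-unique {S = F} hdF′ hdF)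
          where hdF′ = w₀ ∷ eb , LinIndep-∷ eb-indep w₀∉eb , ≐-span-∷ {F = F} F⊆w₀∷X F∩X≐eb w₀∈F

      extensions-cover : ∀ {c : Candidate X j} → (F ∩S span Xh) ≐ span (basis c) →
                         Any (λ c′ → F ≐ span (basis c′)) (extensions c)
      extensions-cover {c} F∩X≐c
        with InSpan-++⁻ (Extension.ext (basisExtension c)) (basis c) (BasisExtension-spans (basisExtension c) u u∈X)
      ... | cR , cE , u≡ = Any.map⁺ (lose (∈-vectors cR) (≐-span-∷ {F = F} F⊆w∷X F∩X≐c w∈F))
        where
        R = Extension.ext (basisExtension c)
        c⊆F : VecAll.All (F ∋_) (basis c)
        c⊆F = VecAll.map (λ {v} v∈c → proj₁ (proj₂ (F∩X≐c v) v∈c)) (InSpan-self (basis c))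
        w∈F : F ∋ (e +V linComb cR R)
        w∈F = ∋-+-cancelʳ F (subst (F ∋_) (trans w₀≡e+u (trans (cong (e +V_) (sym u≡)) (sym (+V.assoc _ _ _)))) w₀∈F)
                            (∋-linComb F cE c⊆F)
        F⊆w∷X : F ⊆S span ((e +V linComb cR R) ∷ Xh)
        F⊆w∷X v v∈F = span-∷-shift (∋-linComb (span Xh) cR (Extension.ext⊆S (basisExtension c))) v (F⊆e∷X v v∈F)

    Covers-step : ∀ {j} {C₁ : List (Candidate X (suc j))} {C₀ : List (Candidate X j)} →
                  Covers X (suc j) C₁ → Covers X j C₀ →
                  Covers (e ∷ X) (suc j) (List.map lift C₁ List.++ List.concatMap extensions C₀)
    Covers-step {j} {C₁} cover₁ cover₀ F F-between@(hdF , hb⊆F , F⊆e∷X)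
      with ∃-vector? (λ f → HasDim-∋? {S = F} hdF f ×-dec ¬? (InSpan? Xh f))
    ... | no ∄f = Any.++⁺ˡ (Any.map⁺ (cover₁ F (hdF , hb⊆F , F⊆X)))
      where
      F⊆X : F ⊆S span Xh
      F⊆X v v∈F = decidable-stable (InSpan? Xh v) λ v∉X → ∄f (v , v∈F , v∉X)
    ... | yes (f , f∈F , f∉X) with InSpan-∷-rescale (F⊆e∷X f f∈F) f∉X
    ...   | a , u , u∈X , af≡e+u = Any.++⁺ʳ (List.map lift C₁) (Any.concatMap⁺ extensions (Any.map
            (extensions-cover {j = j} {F = F} F-between af∈F u∈X af≡e+u)
            (cover₀ (F ∩S span Xh) (section-between {j = j} {F = F} F-between af∈F u∈X af≡e+u))))
      where af∈F = ·∈ F a f∈F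

  -- The q-Pascal recursion: a subspace F of span (e ∷ X ++ hb) either lies in span (X ++ hb),
  -- or meets it in some span E of one dimension less and is spanned by E and e + u, where u
  -- ranges over a complement of span E in span (X ++ hb).
  candidates : ∀ r j (X : Vec (Vect n) r) → LinIndep (X ++ hb) → Candidates X j
  candidates r zero X indep = record
    { list    = candidate hb hb-indep (VecAll.map (InSpan-++ʳ X) (InSpan-self hb)) ∷ []
    ; length≤ = ℕ.≤-refl
    ; covers  = λ F (hdF , hb⊆F , _) → here (HasDim-≐-span {S = F} hdF hb-indep hb⊆F)
    }
    where hb-indep = LinIndep-++⁻ʳ {R = X} indep
  candidates zero (suc j) [] indep = record
    { list    = []
    ; length≤ = z≤n
    ; covers  = λ { F (hdF@(_ , fb-indep , _) , _ , F⊆hb) →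
        ⊥-elim (ℕ.m+n≮n j h (LinIndep-≤-span fb-indep (VecAll.map (F⊆hb _) (HasDim-basis-∈ {W = F} hdF)))) }
    }
  candidates (suc r) (suc j) (e ∷ X) indep = record
    { list    = List.map lift C₁ List.++ List.concatMap extensions C₀
    ; length≤ = length≤
    ; covers  = Covers-step covers₁ covers₀
    }
    where
    open Step e X (LinIndep-∷⁻ indep)
    X-indep = LinIndep-++⁻ʳ {R = e ∷ []} indep
    open Candidates (candidates r (suc j) X X-indep) renaming (list to C₁; length≤ to length-C₁; covers to covers₁)
    open Candidates (candidates r j X X-indep) renaming (list to C₀; length≤ to length-C₀; covers to covers₀)

    length≤ : length (List.map lift C₁ List.++ List.concatMap extensions C₀) ≤ qBinom size (suc r) (suc j)
    length≤ = begin
      length (List.map lift C₁ List.++ List.concatMap extensions C₀)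
        ≡⟨ List.length-++ (List.map lift C₁) ⟩
      length (List.map lift C₁) + length (List.concatMap extensions C₀)
        ≤⟨ ℕ.+-mono-≤ (ℕ.≤-reflexive (List.length-map lift C₁)) (length-concatMap-≤ extensions C₀ length-extensions) ⟩
      length C₁ + length C₀ * size ^ (r ∸ j)
        ≤⟨ ℕ.+-mono-≤ length-C₁ (ℕ.*-monoˡ-≤ (size ^ (r ∸ j)) length-C₀) ⟩
      qBinom size r (suc j) + qBinom size r j * size ^ (r ∸ j)
        ≡⟨ cong (qBinom size r (suc j) +_) (ℕ.*-comm (qBinom size r j) _) ⟩
      qBinom size (suc r) (suc j) ∎
      where open ℕ.≤-Reasoning

-- Families of k-spaces through a subspace

module FamilyBounds (𝔽 : FiniteField) where
  open FiniteField 𝔽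
  open LinAlg 𝔽
  open VectorSpace 𝔽
  private
    module ≐-Counting {n : ℕ} = Counting (≐-setoid n)
  open ≐-Counting

  Containing-AtMost : ∀ {n h k} (𝓕 : Family n) → IsKFamily 𝓕 k → {H : Subspace n} → HasDim H h → h ≤ k →
                      CardAtMost (Containing 𝓕 H) (gauss size (n ∸ h) (k ∸ h))
  Containing-AtMost {n} {h} {k} 𝓕 𝓕-dim {H} hdH@(hb , hb-indep , _) h≤k =
    AtMost-mono id bound (AtMost-⊆-list (List.map (span ∘ Candidate.basis) C) covered)
    where
    open SubspacesThrough 𝔽 hb
    E = extendToBasis {S = ⊤S} (λ _ → yes tt) hb-indep
    open Extension E
    open Candidates (candidates extra (k ∸ h) ext independent) renaming (list to C)

    covered : ∀ {F} → Containing 𝓕 H F → Any (F ≐_) (List.map (span ∘ Candidate.basis) C)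
    covered {F} (F∈𝓕 , H⊆F) = Any.map⁺ (covers F (hdF , hb⊆F , λ v _ → BasisExtension-spans E v tt))
      where
      hdF = subst (HasDim F) (sym (ℕ.m∸n+n≡m h≤k)) (𝓕-dim F F∈𝓕)
      hb⊆F = VecAll.map (H⊆F _) (HasDim-basis-∈ {W = H} hdH)

    bound : length (List.map (span ∘ Candidate.basis) C) ≤ gauss size (n ∸ h) (k ∸ h)
    bound = begin
      length (List.map (span ∘ Candidate.basis) C) ≡⟨ List.length-map _ C ⟩
      length C                                    ≤⟨ length≤ ⟩
      qBinom size extra (k ∸ h)                   ≤⟨ qBinom-mono-≤ size (k ∸ h) extra≤n∸h ⟩
      qBinom size (n ∸ h) (k ∸ h)                 ≡⟨ gauss≡qBinom size (n ∸ h) (k ∸ h) 1<size ⟨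
      gauss size (n ∸ h) (k ∸ h)                  ∎
      where
      open ℕ.≤-Reasoning
      extra≤n∸h = ℕ.m+n≤o⇒m≤o∸n extra (LinIndep-≤-dim independent)

  record Transversal {n} (G H : Subspace n) (w : ℕ) : Set where
    field
      W        : Vec (Vect n) w
      W⊆G      : VecAll.All (G ∋_) W
      W∩H-trivial  : ∀ cs → H ∋ linComb cs W → cs ≡ zeroV

  transversal : ∀ {n k d w} {G H : Subspace n} → HasDim G k → HasDim (H ∩S G) d → w + d ≤ k → Transversal G H w
  transversal {d = d} {w} {G} {H} hdG hdH∩G@(hgb , hgb-indep , H∩G⇔hgb) w+d≤k = record
    { W       = proj₁ trimmed
    ; W⊆G     = proj₂ (proj₂ trimmed)
    ; W∩H-trivial = λ cs W-part∈H →
        let cs′ , W-part≡ = proj₁ (H∩G⇔hgb _) (W-part∈H , ∋-linComb G cs (proj₂ (proj₂ trimmed)))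
        in  proj₁ (LinIndep-++-disjoint (proj₁ (proj₂ trimmed)) {a = cs} {b = cs′} (sym W-part≡))
    }
    where
    E = extendToBasis {S = G} (HasDim-∋? {S = G} hdG) hgb-indep
    open Extension E using (extra; ext; independent; ext⊆S)
    w≤extra : w ≤ extra
    w≤extra = ℕ.+-cancelʳ-≤ d w extra (subst (w + d ≤_) (HasDim-unique {S = G} hdG (BasisExtension-HasDim hgb⊆G E)) w+d≤k)
      where hgb⊆G = VecAll.map proj₂ (HasDim-basis-∈ {W = H ∩S G} hdH∩G)
    trimmed = LinIndep-++-trim (ℕ.≤⇒≤′ w≤extra) ext independent ext⊆S

  length-points≡gauss : ∀ w → length (points w) ≡ gauss size w 1
  length-points≡gauss w = begin
    length (points w)   ≡⟨ length-points w ⟩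
    geomSum size w      ≡⟨ qBinom-1≡geomSum size w ⟨
    qBinom size w 1     ≡⟨ gauss≡qBinom size w 1 1<size ⟨
    gauss size w 1      ∎
    where open ≡-Reasoning

  module CoveringStep {n k t s : ℕ} {𝓕 𝓖 : Family n} (𝓕-dim : IsKFamily 𝓕 k) (𝓖-dim : IsKFamily 𝓖 k) (t≤k : t ≤ k)
                      (aci : AlmostCrossIntersecting s t 𝓕 𝓖) where

    w : ℕ
    w = k ∸ t + 1

    module _ {G H : Subspace n} {h : ℕ} (G∈𝓖 : 𝓖 G) (hdH : HasDim H h) (T : Transversal G H w) where
      open Transversal T
      private
        hb = proj₁ hdH
        hb-indep = proj₁ (proj₂ hdH)
        H⇔hb = proj₂ (proj₂ hdH)

      through : Vect w → Subspace n
      through p = span (linComb p W ∷ hb)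

      through-HasDim : ∀ {p} → ¬ p ≡ zeroV → HasDim (through p) (suc h)
      through-HasDim {p} p≢0 = linComb p W ∷ hb , LinIndep-∷ hb-indep p-part∉hb , λ v → id , id
        where p-part∉hb = λ p-part∈hb → p≢0 (W∩H-trivial p (proj₂ (H⇔hb _) p-part∈hb))

      meets : ∀ {F d} → HasDim (F ∩S G) d → t ≤ d → ∃ λ cs → ¬ cs ≡ zeroV × F ∋ linComb cs W
      meets {F} {d} hdF∩G@(fgb , fgb-indep , F∩G⇔fgb) t≤d with spans-meet fgb-indep fgb⊆gb W⊆gb k<d+w
        where
        G⇔gb = proj₂ (proj₂ (𝓖-dim G G∈𝓖))
        fgb⊆gb = VecAll.map (λ {v} v∈F∩G → proj₁ (G⇔gb v) (proj₂ v∈F∩G)) (HasDim-basis-∈ {W = F ∩S G} hdF∩G)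
        W⊆gb = VecAll.map (λ {v} → proj₁ (G⇔gb v)) W⊆G
        k<d+w : k < d + w
        k<d+w = begin-strict
          k                  ≡⟨ ℕ.m+[n∸m]≡n t≤k ⟨
          t + (k ∸ t)        <⟨ ℕ.m<n+m (t + (k ∸ t)) {1} (s≤s z≤n) ⟩
          1 + (t + (k ∸ t))  ≡⟨ ℕ.+-comm 1 _ ⟩
          t + (k ∸ t) + 1    ≡⟨ ℕ.+-assoc t (k ∸ t) 1 ⟩
          t + w              ≤⟨ ℕ.+-monoˡ-≤ w t≤d ⟩
          d + w              ∎
          where open ℕ.≤-Reasoning
      ... | cs , cs≢0 , W-part∈fgb = cs , cs≢0 , proj₁ (proj₂ (F∩G⇔fgb _) W-part∈fgb)

      classify : ∀ {F} → Containing 𝓕 H F → 𝒟 𝓕 G t F ⊎ Any (λ p → Containing 𝓕 (through p) F) (points w)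
      classify {F} (F∈𝓕 , H⊆F)
        with ∩S-dimension {S = F} {G} (𝓕-dim F F∈𝓕) (𝓖-dim G G∈𝓖)
      ... | d , hdF∩G with d ℕ.<? t
      ...   | yes d<t = inj₁ (F∈𝓕 , d , hdF∩G , d<t)
      ...   | no  d≮t with meets {F} hdF∩G (ℕ.≮⇒≥ d≮t)
      ...     | cs , cs≢0 , W-part∈F = inj₂ (Any.map through⊆F (points-cover cs≢0))
        where
        hb⊆F = VecAll.map (H⊆F _) (HasDim-basis-∈ {W = H} hdH)
        through⊆F : ∀ {p} → (∃ λ l → l ·V cs ≡ p) → Containing 𝓕 (through p) F
        through⊆F {p} (l , lcs≡p) = F∈𝓕 , span-⊆ F (p-part∈F VecAll.∷ hb⊆F)
          where p-part∈F = subst (F ∋_) (trans (sym (linComb-· l cs W)) (cong (λ c → linComb c W) lcs≡p)) (·∈ F l W-part∈F)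

      step-AtMost : ∀ {B} → (∀ {H′} → HasDim H′ (suc h) → CardAtMost (Containing 𝓕 H′) B) →
                    CardAtMost (Containing 𝓕 H) (s + gauss size w 1 * B)
      step-AtMost {B} bound-suc = AtMost-mono classify (ℕ.≤-reflexive (cong (λ x → s + x * B) (length-points≡gauss w)))
        (AtMost-∪ (proj₂ aci G G∈𝓖) (AtMost-⋃ (points w) (All.map through-bound (points-nonzero w))))
        where
        through-bound : ∀ {p} → ¬ p ≡ zeroV → CardAtMost (Containing 𝓕 (through p)) B
        through-bound {p} p≢0 = bound-suc {through p} (through-HasDim p≢0)

  -- Since 𝓖 cannot be searched for a G meeting H in dimension < t, a list exceeding the bound is
  -- used to show instead that H is a t-cover.
  AtMost-unless-cover : ∀ {n k t h b} {𝓖 P : Family n} {H : Subspace n} → IsKFamily 𝓖 k → HasDim H h →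
                        (∀ {G d} → 𝓖 G → HasDim (H ∩S G) d → d < t → AtMost P b) → ¬ IsTCover t 𝓖 H → AtMost P b
  AtMost-unless-cover {t = t} {b = b} {𝓖} {H = H} 𝓖-dim hdH bound ¬cover xs u pxs with length xs ℕ.≤? b
  ... | yes ≤b = ≤b
  ... | no  ≰b = ⊥-elim (¬cover cover)
    where
    cover : IsTCover t 𝓖 H
    cover G G∈𝓖 with ∩S-dimension {S = H} {G} hdH (𝓖-dim G G∈𝓖)
    ... | d , hdH∩G with t ℕ.≤? d
    ...   | yes t≤d = d , hdH∩G , t≤d
    ...   | no  t≰d = ⊥-elim (≰b (bound G∈𝓖 hdH∩G (ℕ.≰⇒> t≰d) xs u pxs))

  module CoveringBound {n k t s : ℕ} {𝓕 𝓖 : Family n} (𝓕-dim : IsKFamily 𝓕 k) (𝓖-dim : IsKFamily 𝓖 k) (t≤k : t ≤ k)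
              (aci : AlmostCrossIntersecting s t 𝓕 𝓖) {τ : ℕ} (τ-cover : IsCoveringNumber t 𝓖 τ) (τ≤k : τ ≤ k) where
    open CoveringStep 𝓕-dim 𝓖-dim t≤k aci

    x g : ℕ
    x = gauss size w 1
    g = gauss size (n ∸ τ) (k ∸ τ)

    w+d≤k : ∀ {d} → d < t → w + d ≤ k
    w+d≤k {d} d<t = begin
      k ∸ t + 1 + d    ≡⟨ ℕ.+-assoc (k ∸ t) 1 d ⟩
      k ∸ t + suc d    ≤⟨ ℕ.+-monoʳ-≤ (k ∸ t) d<t ⟩
      k ∸ t + t        ≡⟨ ℕ.m∸n+n≡m t≤k ⟩
      k                ∎
      where open ℕ.≤-Reasoning

    bound-step : ∀ m → s + x * (x ^ m * g + s * geomSum x m) ≡ x ^ suc m * g + s * geomSum x (suc m)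
    bound-step m = trans (distribute s x (x ^ m) g (geomSum x m)) (cong (λ G → x ^ suc m * g + s * G) (sym (geomSum-suc x m)))
      where
      distribute : ∀ s x p g G → s + x * (p * g + s * G) ≡ x * p * g + s * (1 + x * G)
      distribute = solve-∀

    Containing-bound : ∀ m {H h} → HasDim H h → h + m ≡ τ → CardAtMost (Containing 𝓕 H) (x ^ m * g + s * geomSum x m)
    Containing-bound zero {H} {h} hdH h+0≡τ =
      AtMost-mono id (ℕ.≤-reflexive base≡) (Containing-AtMost 𝓕 𝓕-dim {H} hdH (subst (_≤ k) (sym h≡τ) τ≤k))
      where
      h≡τ = trans (sym (ℕ.+-identityʳ h)) h+0≡τ
      base≡ : gauss size (n ∸ h) (k ∸ h) ≡ x ^ 0 * g + s * geomSum x 0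
      base≡ = trans (cong (λ d → gauss size (n ∸ d) (k ∸ d)) h≡τ)
                    (sym (trans (cong₂ _+_ (ℕ.*-identityˡ g) (ℕ.*-zeroʳ s)) (ℕ.+-identityʳ g)))
    Containing-bound (suc m) {H} {h} hdH h+1+m≡τ = AtMost-unless-cover {H = H} 𝓖-dim hdH
      (λ {G} G∈𝓖 hdH∩G d<t → AtMost-mono id (ℕ.≤-reflexive (bound-step m))
         (step-AtMost {G = G} {H} G∈𝓖 hdH (transversal {G = G} {H} (𝓖-dim G G∈𝓖) hdH∩G (w+d≤k d<t))
            (λ {H′} hdH′ → Containing-bound m {H′} hdH′ (trans (sym (ℕ.+-suc h m)) h+1+m≡τ))))
      (λ H-cover → ℕ.<⇒≱ h<τ (proj₂ τ-cover H h hdH H-cover))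
      where
      h<τ : h < τ
      h<τ = subst (h <_) h+1+m≡τ (ℕ.m<m+n h (s≤s z≤n))

lemma3p1 : (𝔽 : FiniteField) →
    (n k t s : ℕ) → 1 ≤ n → 1 ≤ k → 1 ≤ t → 1 ≤ s → t + 1 ≤ k → 2 * k ≤ n →
    (𝓕 𝓖 : LinAlg.Family 𝔽 n) → LinAlg.IsKFamily 𝔽 𝓕 k → LinAlg.IsKFamily 𝔽 𝓖 k →
    LinAlg.NonEmpty 𝔽 𝓕 → LinAlg.NonEmpty 𝔽 𝓖 →
    LinAlg.AlmostCrossIntersecting 𝔽 s t 𝓕 𝓖 →
    (τ : ℕ) → LinAlg.IsCoveringNumber 𝔽 t 𝓖 τ → τ ≤ k →
    (H : LinAlg.Subspace 𝔽 n) (h : ℕ) → LinAlg.HasDim 𝔽 H h → h ≤ τ →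
    LinAlg.CardAtMost 𝔽 (LinAlg.Containing 𝔽 𝓕 H)
      (gauss (FiniteField.size 𝔽) (k ∸ t + 1) 1 ^ (τ ∸ h)
          * gauss (FiniteField.size 𝔽) (n ∸ τ) (k ∸ τ)
        + s * geomSum (gauss (FiniteField.size 𝔽) (k ∸ t + 1) 1) (τ ∸ h))
lemma3p1 𝔽 n k t s _ _ _ _ t+1≤k _ 𝓕 𝓖 𝓕-dim 𝓖-dim _ _ aci τ τ-cover τ≤k H h hdH h≤τ =
  Containing-bound (τ ∸ h) {H} hdH (ℕ.m+[n∸m]≡n h≤τ)
  where
  open FamilyBounds 𝔽
  open CoveringBound 𝓕-dim 𝓖-dim (ℕ.≤-trans (ℕ.m≤m+n t 1) t+1≤k) aci τ-cover τ≤k
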